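{- Let $G$ be a graph, let $H$ be any subgraph of $\overline{G}$, and let $k\geq\chi(G)$ be an integer. (i) If $G$ is a tree, then $m(G,H,k)\leq\frac{|E(H)|}{k-1}$. (ii) If $G$ is a simple series-parallel graph with $\chi(G)=3$, then $m(G,H,k)\leq\frac{|E(H)|}{k-2}$. (iii) If $G$ is a simple bipartite outerplanar graph and $k>2$, then $m(G,H,k)\leq\frac{|E(H)|}{k-2}$. (iv) If $G$ is an $\ell$-tree with chromatic number $\ell+1$, then $m(G,H,k)\leq\frac{|E(H)|}{k-\ell}$.
   Context: All graphs are finite, simple and unweighted; $\overline{G}$ is the complement of $G$ and $\chi(G)$ its chromatic number. A $k$-coloring of $G$ is a map $\phi:V(G)\to\{1,\dots,k\}$ with $\phi(u)\neq\phi(v)$ for every edge $uv$ of $G$; for a subgraph $H$ of $\overline{G}$ an edge $uv$ of $H$ is monochromatic if $\phi(u)=\phi(v)$, and for $k\geq\chi(G)$, $m(G,H,k)$ is the minimum over all $k$-colorings of $G$ of the number of monochromatic edges of $H$. A simple series-parallel graph is a simple graph that can be turned into $K_2$ by a sequence of the operations: identifying a vertex of degree two with one of its neighbours (replacing its two incident edges by one), and deleting parallel edges (keeping one copy). An $\ell$-tree is a graph obtained from a complete graph on $\ell+1$ vertices by repeatedly adding a new vertex adjacent to exactly $\ell$ existing vertices that form a clique. -}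

module Defs where

open import Data.Nat using (ℕ; zero; suc; _+_; _*_; _∸_; _≤_; _<_; _<?_)
open import Data.Fin using (Fin; zero; suc; toℕ; punchIn; _≟_)
open import Data.Bool using (Bool; true; false; not; _∧_; _∨_; if_then_else_)
open import Data.Product using (Σ; _×_; _,_; ∃)
open import Data.List using (List; []; _∷_; length)
open import Data.List.Relation.Unary.Unique.Propositional using (Unique)
open import Data.Empty using (⊥)
open import Relation.Nullary using (¬_; does)
open import Relation.Binary.PropositionalEquality using (_≡_; _≢_)
open import Function.Definitions using (Injective)

record Graph (n : ℕ) : Set where
  field
    adj    : Fin n → Fin n → Bool
    sym    : ∀ i j → adj i j ≡ adj j i
    irrefl : ∀ i → adj i i ≡ false
open Graph public

Edge : ∀ {n} → Graph n → Fin n → Fin n → Set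
Edge G u v = adj G u v ≡ true

count : ∀ {n} → (Fin n → Bool) → ℕ
count {zero}  p = 0
count {suc n} p = (if p zero then 1 else 0) + count (λ x → p (suc x))

sumFin : ∀ {n} → (Fin n → ℕ) → ℕ
sumFin {zero}  f = 0
sumFin {suc n} f = f zero + sumFin (λ x → f (suc x))

countPairs : ∀ {n} → (Fin n → Fin n → Bool) → ℕ
countPairs {n} p = sumFin (λ i → count (λ j → does (toℕ i <? toℕ j) ∧ p i j))

numEdges : ∀ {n} → Graph n → ℕ
numEdges G = countPairs (adj G)

SubgraphOfComplement : ∀ {n} → Graph n → Graph n → Set
SubgraphOfComplement H G =
  ∀ u v → adj H u v ≡ true → (adj G u v ≡ false × u ≢ v)

ProperColoring : ∀ {n} → Graph n → (k : ℕ) → (Fin n → Fin k) → Set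
ProperColoring G k φ = ∀ u v → Edge G u v → φ u ≢ φ v

Colorable : ∀ {n} → Graph n → ℕ → Set
Colorable {n} G k = Σ (Fin n → Fin k) (ProperColoring G k)

IsChromaticNumber : ∀ {n} → Graph n → ℕ → Set
IsChromaticNumber G c = Colorable G c × (∀ c' → Colorable G c' → c ≤ c')

mono : ∀ {n k} → Graph n → (Fin n → Fin k) → ℕ
mono H φ = countPairs (λ u v → adj H u v ∧ does (φ u ≟ φ v))

IsMinMono : ∀ {n} → Graph n → Graph n → ℕ → ℕ → Set
IsMinMono {n} G H k m =
  Σ (Fin n → Fin k) (λ φ → ProperColoring G k φ × mono H φ ≡ m)
  × (∀ φ → ProperColoring G k φ → m ≤ mono H φ)

data Walk {n} (G : Graph n) : Fin n → Fin n → Set where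
  here : ∀ u → Walk G u u
  step : ∀ u w v → Edge G u w → Walk G w v → Walk G u v

Connected : ∀ {n} → Graph n → Set
Connected {n} G = ∀ (u v : Fin n) → Walk G u v

data Path {n} (G : Graph n) : List (Fin n) → Set where
  single : ∀ u → Path G (u ∷ [])
  cons   : ∀ u w ws → Edge G u w → Path G (w ∷ ws) → Path G (u ∷ w ∷ ws)

data LastIs {n} : List (Fin n) → Fin n → Set where
  lastOne  : ∀ x → LastIs (x ∷ []) x
  lastMore : ∀ x y ys z → LastIs (y ∷ ys) z → LastIs (x ∷ y ∷ ys) z

HasCycle : ∀ {n} → Graph n → Set
HasCycle {n} G =
  Σ (List (Fin n)) λ cyc → Σ (Fin n) λ v₀ → Σ (Fin n) λ vlast →
    (3 ≤ length cyc) × Unique cyc × Path G cyc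
    × Head cyc v₀ × LastIs cyc vlast × Edge G vlast v₀
  where
  Head : List (Fin n) → Fin n → Set
  Head []      _ = ⊥
  Head (x ∷ _) y = x ≡ y

IsTree : ∀ {n} → Graph n → Set
IsTree {n} G = (1 ≤ n) × Connected G × ¬ HasCycle G

-- multigraphs: symmetric edge multiplicities (no loops)
MG : ℕ → Set
MG n = Fin n → Fin n → ℕ

toMG : ∀ {n} → Graph n → MG n
toMG G i j = if adj G i j then 1 else 0

mdeg : ∀ {n} → MG n → Fin n → ℕ
mdeg M v = sumFin (M v)

bump : ∀ {n} → Fin n → Fin n → Fin n → Fin n → ℕ
bump a b i j =
  if (does (i ≟ a) ∧ does (j ≟ b)) ∨ (does (i ≟ b) ∧ does (j ≟ a)) then 1 else 0

-- ReducesToK2 M : M can be turned into K₂ by the two operations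
--  * suppressing a vertex v of degree two with (distinct) neighbours a, b:
--    v is identified with a neighbour, i.e. v is deleted and its two
--    incident edges va, vb are replaced by one edge ab (which may create
--    a parallel edge); a, b below are indices in the remaining graph;
--  * deleting one copy of an edge of multiplicity ≥ 2.
data ReducesToK2 : ∀ {n} → MG n → Set where
  isK2 : (M : MG 2) → (∀ i j → M i j ≡ (if does (i ≟ j) then 0 else 1))
       → ReducesToK2 M
  suppress : ∀ {n} (M : MG (suc n)) (v : Fin (suc n)) (a b : Fin n)
       → a ≢ b
       → mdeg M v ≡ 2
       → M v (punchIn v a) ≡ 1
       → M v (punchIn v b) ≡ 1
       → ReducesToK2 {n} (λ i j → M (punchIn v i) (punchIn v j) + bump a b i j)
       → ReducesToK2 M
  delParallel : ∀ {n} (M : MG n) (a b : Fin n)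
       → a ≢ b
       → 2 ≤ M a b
       → ReducesToK2 (λ i j → M i j ∸ bump a b i j)
       → ReducesToK2 M

IsSeriesParallel : ∀ {n} → Graph n → Set
IsSeriesParallel G = ReducesToK2 (toMG G)

IsBipartite : ∀ {n} → Graph n → Set
IsBipartite G = Colorable G 2

-- Outerplanar: the vertices can be placed in a cyclic order (positions σ,
-- a bijection Fin n → Fin n) such that no two edges cross, i.e. there are
-- no edges ab, cd with σa < σc < σb < σd (convex / one-page drawing).
IsOuterplanar : ∀ {n} → Graph n → Set
IsOuterplanar {n} G =
  Σ (Fin n → Fin n) λ σ → Injective _≡_ _≡_ σ ×
    (∀ a b c d → Edge G a b → Edge G c d →
      ¬ (toℕ (σ a) < toℕ (σ c) × toℕ (σ c) < toℕ (σ b) × toℕ (σ b) < toℕ (σ d)))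

deleteVertex : ∀ {n} → Graph (suc n) → Fin (suc n) → Graph n
deleteVertex G v = record
  { adj    = λ i j → adj G (punchIn v i) (punchIn v j)
  ; sym    = λ i j → sym G (punchIn v i) (punchIn v j)
  ; irrefl = λ i → irrefl G (punchIn v i)
  }

IsComplete : ∀ {n} → Graph n → Set
IsComplete {n} G = ∀ (u v : Fin n) → u ≢ v → Edge G u v

degree : ∀ {n} → Graph n → Fin n → ℕ
degree G v = count (adj G v)

data IsLTree (ℓ : ℕ) : ∀ {n} → Graph n → Set where
  base : (G : Graph (suc ℓ)) → IsComplete G → IsLTree ℓ G
  add  : ∀ {n} (G : Graph (suc n)) (v : Fin (suc n))
       → degree G v ≡ ℓ
       → (∀ a b → Edge G v a → Edge G v b → a ≢ b → Edge G a b)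
       → IsLTree ℓ (deleteVertex G v)
       → IsLTree ℓ G

module Submission where

open import Defs
open import Data.Nat using (ℕ; zero; suc; _+_; _*_; _∸_; _≤_; _<_; z≤n; s≤s; _<?_; _≤?_)
open import Data.Nat.Properties
  using ( +-*-semiring; +-commutativeSemigroup; +-identityʳ; +-comm; +-assoc; +-suc
        ; *-comm; *-identityʳ; *-distribʳ-+; *-cancelˡ-≡; *-zeroʳ
        ; *-monoˡ-≤; *-monoʳ-≤; +-mono-≤; +-monoʳ-≤; +-cancelˡ-≤; m≤n+m; n≤1+n
        ; ≤-refl; ≤-trans; ≤-reflexive; <-cmp; <⇒≱; <⇒≤; ≤-<-trans; <-trans; ≮⇒≥; ≤∧≢⇒<; ≤-pred
        ; n≮0; 1+n≰n; m<n⇒0<n∸m; m+[n∸m]≡n; m≤n⇒m∸n≡0; ∸-monoˡ-≤; ∸-monoʳ-<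
        ; module ≤-Reasoning )
open import Data.Fin using (Fin; zero; suc; toℕ; punchIn; punchOut; _≟_)
open import Data.Fin.Properties
  using (any?; injective⇒≤; suc-injective; toℕ-injective; punchIn-injective; punchInᵢ≢i; punchIn-punchOut)
open import Data.Vec.Functional using (insertAt)
open import Data.Vec.Functional.Properties using (insertAt-lookup; insertAt-punchIn)
open import Data.Bool using (Bool; true; false; not; _∧_; _∨_; if_then_else_)
import Data.Bool.Properties as Bool
open import Data.Product using (Σ; ∃; _×_; _,_; proj₂)
open import Data.Sum using (_⊎_; inj₁; inj₂)
open import Data.Empty using (⊥-elim)
open import Data.Unit using (tt)
open import Data.List using (List; []; _∷_; length; lookup; map)
open import Data.List.Properties using (length-map)
open import Data.List.Relation.Unary.All using (All; []; _∷_)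
import Data.List.Relation.Unary.All as All
open import Data.List.Relation.Unary.All.Properties using (¬Any⇒All¬)
open import Data.List.Relation.Unary.Any using (here; there)
import Data.List.Relation.Unary.Any as Any
open import Data.List.Relation.Unary.AllPairs using ([]; _∷_)
open import Data.List.Relation.Unary.Unique.Propositional using (Unique)
open import Data.List.Relation.Unary.Unique.Propositional.Properties using (map⁺)
open import Data.List.Membership.Propositional using (_∈_)
open import Data.List.Membership.Propositional.Properties using (∈-lookup)
open import Function using (_∘_)
open import Function.Definitions using (Injective)
open import Relation.Nullary using (¬_; ¬?; Dec; yes; no; does)
open import Relation.Nullary.Decidable using (dec-true; dec-false; decidable-stable; _×-dec_; map′)
open import Relation.Unary using (Decidable)
open import Relation.Binary using (tri<; tri≈; tri>)
open import Relation.Binary.PropositionalEquality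
  using (_≡_; _≢_; refl; trans; cong; cong₂; subst; module ≡-Reasoning) renaming (sym to ≡-sym)
open import Algebra.Properties.CommutativeSemigroup +-commutativeSemigroup using (interchange)
open import Algebra.Properties.Semiring.Sum +-*-semiring using (sum; sum-remove; ∑-distrib-+; ∑-comm)

-- Each of the four classes consists of d-degenerate graphs, for d = 1, 2, 2 and ℓ:
-- the graph can be dismantled by repeatedly deleting a vertex with at most d
-- remaining neighbours (a leaf of a forest; the suppressed vertex of a
-- series-parallel reduction; the first vertex under a shortest chord of an
-- outerplanar drawing; the last vertex added to an ℓ-tree).  Colour the vertices
-- greedily in the reverse order with k = d + t colours.  When v is put back, its
-- G-neighbours block at most d colours; among the at least t free ones, the colour
-- least used on the H-neighbours of v creates at most deg_H(v) / t monochromatic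
-- edges.  Summing over v gives m t ≤ |E(H)|.

private variable
  n k : ℕ

𝟙 : Bool → ℕ
𝟙 b = if b then 1 else 0

𝟙≤1 : ∀ b → 𝟙 b ≤ 1
𝟙≤1 false = z≤n
𝟙≤1 true  = ≤-refl

positive : ℕ → Bool
positive zero    = false
positive (suc _) = true

sumFin≡sum : (f : Fin n → ℕ) → sumFin f ≡ sum f
sumFin≡sum {zero}  f = refl
sumFin≡sum {suc n} f = cong (f zero +_) (sumFin≡sum (f ∘ suc))

count≡sumFin : (p : Fin n → Bool) → count p ≡ sumFin (𝟙 ∘ p)
count≡sumFin {zero}  p = refl
count≡sumFin {suc n} p = cong (𝟙 (p zero) +_) (count≡sumFin (p ∘ suc))

sumFin-cong : {f g : Fin n → ℕ} → (∀ x → f x ≡ g x) → sumFin f ≡ sumFin g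
sumFin-cong {zero}  f≗g = refl
sumFin-cong {suc n} f≗g = cong₂ _+_ (f≗g zero) (sumFin-cong (f≗g ∘ suc))

sumFin-remove : (v : Fin (suc n)) (f : Fin (suc n) → ℕ) → sumFin f ≡ f v + sumFin (f ∘ punchIn v)
sumFin-remove v f = begin
  sumFin f                      ≡⟨ sumFin≡sum f ⟩
  sum f                         ≡⟨ sum-remove f ⟩
  f v + sum (f ∘ punchIn v)     ≡⟨ cong (f v +_) (≡-sym (sumFin≡sum (f ∘ punchIn v))) ⟩
  f v + sumFin (f ∘ punchIn v)  ∎
  where open ≡-Reasoning

sumFin-distrib-+ : (f g : Fin n → ℕ) → sumFin (λ x → f x + g x) ≡ sumFin f + sumFin g
sumFin-distrib-+ f g = begin
  sumFin (λ x → f x + g x)  ≡⟨ sumFin≡sum (λ x → f x + g x) ⟩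
  sum (λ x → f x + g x)     ≡⟨ ∑-distrib-+ f g ⟩
  sum f + sum g             ≡⟨ ≡-sym (cong₂ _+_ (sumFin≡sum f) (sumFin≡sum g)) ⟩
  sumFin f + sumFin g       ∎
  where open ≡-Reasoning

sumFin-comm : ∀ {m} (f : Fin m → Fin n → ℕ) →
              sumFin (λ i → sumFin (f i)) ≡ sumFin (λ j → sumFin (λ i → f i j))
sumFin-comm f = begin
  sumFin (λ i → sumFin (f i))          ≡⟨ sumFin-cong (λ i → sumFin≡sum (f i)) ⟩
  sumFin (λ i → sum (f i))             ≡⟨ sumFin≡sum (λ i → sum (f i)) ⟩
  sum (λ i → sum (f i))                ≡⟨ ∑-comm f ⟩
  sum (λ j → sum (λ i → f i j))        ≡⟨ ≡-sym (sumFin≡sum (λ j → sum (λ i → f i j))) ⟩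
  sumFin (λ j → sum (λ i → f i j))     ≡⟨ ≡-sym (sumFin-cong (λ j → sumFin≡sum (λ i → f i j))) ⟩
  sumFin (λ j → sumFin (λ i → f i j))  ∎
  where open ≡-Reasoning

count-cong : {p q : Fin n → Bool} → (∀ x → p x ≡ q x) → count p ≡ count q
count-cong {zero}  p≗q = refl
count-cong {suc n} p≗q = cong₂ _+_ (cong 𝟙 (p≗q zero)) (count-cong (p≗q ∘ suc))

count-mono : {p q : Fin n → Bool} → (∀ x → p x ≡ true → q x ≡ true) → count p ≤ count q
count-mono {zero}          p⊆q = z≤n
count-mono {suc n} {p} {q} p⊆q = +-mono-≤ (𝟙-mono (p zero) (q zero) (p⊆q zero)) (count-mono (p⊆q ∘ suc))
  where
  𝟙-mono : ∀ a b → (a ≡ true → b ≡ true) → 𝟙 a ≤ 𝟙 b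
  𝟙-mono false _ _                     = z≤n
  𝟙-mono true  b a⇒b rewrite a⇒b refl = ≤-refl

count-false : {p : Fin n → Bool} → (∀ x → p x ≡ false) → count p ≡ 0
count-false {zero}  _     = refl
count-false {suc n} never rewrite never zero = count-false (never ∘ suc)

count≤n : (p : Fin n → Bool) → count p ≤ n
count≤n {zero}  p = z≤n
count≤n {suc n} p = +-mono-≤ (𝟙≤1 (p zero)) (count≤n (p ∘ suc))

count-not : (p : Fin n → Bool) → count (not ∘ p) + count p ≡ n
count-not {zero}  p = refl
count-not {suc n} p with p zero
... | true  = trans (+-suc _ _) (cong suc (count-not (p ∘ suc)))
... | false = cong suc (count-not (p ∘ suc))

count-remove : (v : Fin (suc n)) (p : Fin (suc n) → Bool) → count p ≡ 𝟙 (p v) + count (p ∘ punchIn v)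
count-remove v p = begin
  count p                              ≡⟨ count≡sumFin p ⟩
  sumFin (𝟙 ∘ p)                       ≡⟨ sumFin-remove v (𝟙 ∘ p) ⟩
  𝟙 (p v) + sumFin (𝟙 ∘ p ∘ punchIn v) ≡⟨ cong (𝟙 (p v) +_) (≡-sym (count≡sumFin (p ∘ punchIn v))) ⟩
  𝟙 (p v) + count (p ∘ punchIn v)      ∎
  where open ≡-Reasoning

count-punchIn≤ : (v : Fin (suc n)) (p : Fin (suc n) → Bool) → count (p ∘ punchIn v) ≤ count p
count-punchIn≤ v p = subst (count (p ∘ punchIn v) ≤_) (≡-sym (count-remove v p)) (m≤n+m _ _)

count≡0⇒false : {p : Fin n → Bool} → count p ≡ 0 → ∀ x → p x ≡ false
count≡0⇒false {suc n} {p} count≡0 x with p x in px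
... | false = refl
... | true with () ← trans (≡-sym count≡0) (trans (count-remove x p) (cong (λ b → 𝟙 b + count (p ∘ punchIn x)) px))

count>0⇒∃ : {p : Fin n → Bool} → 1 ≤ count p → ∃ λ x → p x ≡ true
count>0⇒∃ {suc n} {p} count≥1 with p zero in p0
... | true  = zero , p0
... | false = let x , px = count>0⇒∃ count≥1 in suc x , px

count*≤sumFin : (p : Fin n → Bool) (f : Fin n → ℕ) {m : ℕ} →
                (∀ x → p x ≡ true → m ≤ f x) → count p * m ≤ sumFin f
count*≤sumFin {zero}  p f       _        = z≤n
count*≤sumFin {suc n} p f {m} m≤f = begin
  (𝟙 (p zero) + count (p ∘ suc)) * m
    ≡⟨ *-distribʳ-+ m (𝟙 (p zero)) (count (p ∘ suc)) ⟩
  𝟙 (p zero) * m + count (p ∘ suc) * m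
    ≤⟨ +-mono-≤ (𝟙*≤ (p zero) (m≤f zero)) (count*≤sumFin (p ∘ suc) (f ∘ suc) (m≤f ∘ suc)) ⟩
  f zero + sumFin (f ∘ suc)
    ∎
  where
  open ≤-Reasoning
  𝟙*≤ : ∀ b → (b ≡ true → m ≤ f zero) → 𝟙 b * m ≤ f zero
  𝟙*≤ false _  = z≤n
  𝟙*≤ true  m≤ = ≤-trans (≤-reflexive (+-identityʳ m)) (m≤ refl)

count-positive≤sumFin : (f : Fin n → ℕ) → count (positive ∘ f) ≤ sumFin f
count-positive≤sumFin f =
  subst (_≤ sumFin f) (*-identityʳ _) (count*≤sumFin (positive ∘ f) f (λ x → positive⇒1≤ (f x)))
  where
  positive⇒1≤ : ∀ m → positive m ≡ true → 1 ≤ m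
  positive⇒1≤ (suc m) _ = s≤s z≤n

count≤1 : {p : Fin n → Bool} → (∀ x y → p x ≡ true → p y ≡ true → x ≡ y) → count p ≤ 1
count≤1 {zero}      _         = z≤n
count≤1 {suc n} {p} atMostOne with p zero in p0
... | true  = ≤-reflexive (cong suc (count-false rest-false))
  where
  rest-false : ∀ x → p (suc x) ≡ false
  rest-false x with p (suc x) in px
  ... | false = refl
  ... | true with () ← atMostOne zero (suc x) p0 px
... | false = count≤1 (λ x y px py → suc-injective (atMostOne (suc x) (suc y) px py))

count≤2 : {p : Fin n → Bool} (a : Fin n) (R : Fin n → Set) →
          (∀ x → p x ≡ true → x ≡ a ⊎ R x) → (∀ x y → R x → R y → x ≡ y) → count p ≤ 2
count≤2 {suc n} {p} a R a-or-R R-unique = begin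
  count p                          ≡⟨ count-remove a p ⟩
  𝟙 (p a) + count (p ∘ punchIn a)  ≤⟨ +-mono-≤ (𝟙≤1 (p a)) (count≤1 rest-unique) ⟩
  2                                ∎
  where
  open ≤-Reasoning
  in-R : ∀ x → p (punchIn a x) ≡ true → R (punchIn a x)
  in-R x px with a-or-R (punchIn a x) px
  ... | inj₁ x≡a = ⊥-elim (punchInᵢ≢i a x x≡a)
  ... | inj₂ r   = r
  rest-unique : ∀ x y → p (punchIn a x) ≡ true → p (punchIn a y) ≡ true → x ≡ y
  rest-unique x y px py = punchIn-injective a x y (R-unique _ _ (in-R x px) (in-R y py))

count-singleton : (x : Fin n) → count (λ c → does (c ≟ x)) ≡ 1
count-singleton {suc n} x = begin
  count (λ c → does (c ≟ x))
    ≡⟨ count-remove x (λ c → does (c ≟ x)) ⟩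
  𝟙 (does (x ≟ x)) + count (λ y → does (punchIn x y ≟ x))
    ≡⟨ cong₂ _+_ (cong 𝟙 (dec-true (x ≟ x) refl))
                 (count-false (λ y → dec-false (punchIn x y ≟ x) (punchInᵢ≢i x y))) ⟩
  1
    ∎
  where open ≡-Reasoning

clashes : (Fin n → Bool) → (Fin n → Fin k) → Fin k → ℕ
clashes p ψ c = count (λ u → p u ∧ does (c ≟ ψ u))

sumFin-clashes : (p : Fin n → Bool) (ψ : Fin n → Fin k) → sumFin (clashes p ψ) ≡ count p
sumFin-clashes {k = k} p ψ = begin
  sumFin (clashes p ψ)
    ≡⟨ sumFin-cong (λ c → count≡sumFin (λ u → p u ∧ does (c ≟ ψ u))) ⟩
  sumFin (λ c → sumFin (λ u → 𝟙 (p u ∧ does (c ≟ ψ u))))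
    ≡⟨ sumFin-comm (λ c u → 𝟙 (p u ∧ does (c ≟ ψ u))) ⟩
  sumFin (λ u → sumFin (λ c → 𝟙 (p u ∧ does (c ≟ ψ u))))
    ≡⟨ sumFin-cong (λ u → ≡-sym (count≡sumFin (λ c → p u ∧ does (c ≟ ψ u)))) ⟩
  sumFin (λ u → count (λ c → p u ∧ does (c ≟ ψ u)))
    ≡⟨ sumFin-cong (λ u → fibre (p u) (ψ u)) ⟩
  sumFin (𝟙 ∘ p)
    ≡⟨ ≡-sym (count≡sumFin p) ⟩
  count p
    ∎
  where
  open ≡-Reasoning
  fibre : ∀ b (x : Fin k) → count (λ c → b ∧ does (c ≟ x)) ≡ 𝟙 b
  fibre true  x = count-singleton x
  fibre false x = count-false {k} (λ _ → refl)

∃-minimal : {X : Set} (P : X → Set) (μ : X → ℕ) → (∀ b → Dec (∃ λ x → P x × μ x < b)) →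
            ∃ P → ∃ λ x → P x × (∀ y → P y → μ x ≤ μ y)
∃-minimal {X} P μ below? (x₀ , px₀) = descend (μ x₀) x₀ px₀ ≤-refl
  where
  descend : (b : ℕ) (x : X) → P x → μ x ≤ b → ∃ λ x → P x × (∀ y → P y → μ x ≤ μ y)
  descend b x px μx≤b with below? (μ x)
  ... | no none = x , px , λ y py → ≮⇒≥ (λ μy<μx → none (y , py , μy<μx))
  descend zero    x px μx≤0 | yes (y , py , μy<μx) = ⊥-elim (n≮0 (≤-trans μy<μx μx≤0))
  descend (suc b) x px μx≤b | yes (y , py , μy<μx) = descend b y py (≤-pred (≤-trans μy<μx μx≤b))

Fin-∃-minimal : {P : Fin n → Set} → Decidable P → (μ : Fin n → ℕ) →
                ∃ P → ∃ λ x → P x × (∀ y → P y → μ x ≤ μ y)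
Fin-∃-minimal {P = P} P? μ = ∃-minimal P μ (λ b → any? (λ x → P? x ×-dec μ x <? b))

pair-any? : {P : Fin n × Fin n → Set} → Decidable P → Dec (∃ P)
pair-any? P? = map′ (λ { (a , b , p) → (a , b) , p }) (λ { ((a , b) , p) → a , b , p })
                    (any? (λ a → any? (λ b → P? (a , b))))

removeVertex : {A : Set} → (Fin (suc n) → Fin (suc n) → A) → Fin (suc n) → Fin n → Fin n → A
removeVertex p v i j = p (punchIn v i) (punchIn v j)

neighbours : (Fin (suc n) → Fin (suc n) → Bool) → (v : Fin (suc n)) → Fin n → Bool
neighbours p v u = p v (punchIn v u)

Edge-sym : (G : Graph n) {x y : Fin n} → Edge G x y → Edge G y x
Edge-sym G {x} {y} x~y = trans (sym G y x) x~y

Edge-irrefl : (G : Graph n) {x y : Fin n} → Edge G x y → x ≢ y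
Edge-irrefl G {x} x~x refl with () ← trans (≡-sym x~x) (irrefl G x)

countOrdered : (Fin n → Fin n → Bool) → ℕ
countOrdered p = sumFin (λ i → count (p i))

module _ (p : Fin n → Fin n → Bool) (p-sym : ∀ i j → p i j ≡ p j i) (p-irrefl : ∀ i → p i i ≡ false) where

  countPairs-double : countPairs p + countPairs p ≡ countOrdered p
  countPairs-double = ≡-sym (begin
    sumFin (λ i → count (p i))
      ≡⟨ sumFin-cong (λ i → count≡sumFin (p i)) ⟩
    sumFin (λ i → sumFin (λ j → 𝟙 (p i j)))
      ≡⟨ sumFin-cong (λ i → sumFin-cong (split i)) ⟩
    sumFin (λ i → sumFin (λ j → a i j + a j i))
      ≡⟨ sumFin-cong (λ i → sumFin-distrib-+ (a i) (λ j → a j i)) ⟩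
    sumFin (λ i → sumFin (a i) + sumFin (λ j → a j i))
      ≡⟨ sumFin-distrib-+ (λ i → sumFin (a i)) (λ i → sumFin (λ j → a j i)) ⟩
    sumFin (λ i → sumFin (a i)) + sumFin (λ i → sumFin (λ j → a j i))
      ≡⟨ cong (sumFin (λ i → sumFin (a i)) +_) (sumFin-comm (λ i j → a j i)) ⟩
    sumFin (λ i → sumFin (a i)) + sumFin (λ i → sumFin (a i))
      ≡⟨ cong₂ _+_ pairs pairs ⟩
    countPairs p + countPairs p
      ∎)
    where
    open ≡-Reasoning
    a : Fin n → Fin n → ℕ
    a i j = 𝟙 (does (toℕ i <? toℕ j) ∧ p i j)
    split : ∀ i j → 𝟙 (p i j) ≡ a i j + a j i
    split i j with <-cmp (toℕ i) (toℕ j)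
    ... | tri< i<j _ j≮i rewrite dec-true (toℕ i <? toℕ j) i<j | dec-false (toℕ j <? toℕ i) j≮i =
      ≡-sym (+-identityʳ (𝟙 (p i j)))
    ... | tri> i≮j _ j<i rewrite dec-false (toℕ i <? toℕ j) i≮j | dec-true (toℕ j <? toℕ i) j<i =
      cong 𝟙 (p-sym i j)
    ... | tri≈ i≮j i≡j _ rewrite toℕ-injective {i = i} {j = j} i≡j | dec-false (toℕ j <? toℕ j) i≮j | p-irrefl j =
      refl
    pairs : sumFin (λ i → sumFin (a i)) ≡ countPairs p
    pairs = sumFin-cong (λ i → ≡-sym (count≡sumFin (λ j → does (toℕ i <? toℕ j) ∧ p i j)))

module _ {n} (p : Fin (suc n) → Fin (suc n) → Bool) (p-sym : ∀ i j → p i j ≡ p j i) (p-irrefl : ∀ i → p i i ≡ false)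
         (v : Fin (suc n)) where

  private
    deg : ℕ
    deg = count (neighbours p v)

  countOrdered-removeVertex : countOrdered p ≡ deg + deg + countOrdered (removeVertex p v)
  countOrdered-removeVertex = begin
    sumFin (λ i → count (p i))
      ≡⟨ sumFin-remove v (λ i → count (p i)) ⟩
    count (p v) + sumFin (λ i → count (p (punchIn v i)))
      ≡⟨ cong₂ _+_ (count-remove v (p v)) (sumFin-cong (λ i → count-remove v (p (punchIn v i)))) ⟩
    𝟙 (p v v) + deg + sumFin (λ i → 𝟙 (p (punchIn v i) v) + count (removeVertex p v i))
      ≡⟨ cong₂ _+_ (cong (λ b → 𝟙 b + deg) (p-irrefl v))
                   (sumFin-distrib-+ (λ i → 𝟙 (p (punchIn v i) v)) (λ i → count (removeVertex p v i))) ⟩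
    deg + (sumFin (λ i → 𝟙 (p (punchIn v i) v)) + countOrdered (removeVertex p v))
      ≡⟨ cong (λ column → deg + (column + countOrdered (removeVertex p v))) column≡deg ⟩
    deg + (deg + countOrdered (removeVertex p v))
      ≡⟨ ≡-sym (+-assoc deg deg (countOrdered (removeVertex p v))) ⟩
    deg + deg + countOrdered (removeVertex p v)
      ∎
    where
    open ≡-Reasoning
    column≡deg : sumFin (λ i → 𝟙 (p (punchIn v i) v)) ≡ deg
    column≡deg = trans (≡-sym (count≡sumFin (λ i → p (punchIn v i) v))) (count-cong (λ i → p-sym (punchIn v i) v))

  countPairs-removeVertex : countPairs p ≡ count (neighbours p v) + countPairs (removeVertex p v)
  countPairs-removeVertex = halve (begin
    countPairs p + countPairs p                    ≡⟨ countPairs-double p p-sym p-irrefl ⟩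
    countOrdered p                                 ≡⟨ countOrdered-removeVertex ⟩
    deg + deg + countOrdered p′                    ≡⟨ cong (deg + deg +_) (≡-sym (countPairs-double p′ p′-sym p′-irrefl)) ⟩
    deg + deg + (countPairs p′ + countPairs p′)    ≡⟨ interchange deg deg (countPairs p′) (countPairs p′) ⟩
    (deg + countPairs p′) + (deg + countPairs p′)  ∎)
    where
    open ≡-Reasoning
    p′ : Fin n → Fin n → Bool
    p′ = removeVertex p v
    p′-sym : ∀ i j → p′ i j ≡ p′ j i
    p′-sym i j = p-sym (punchIn v i) (punchIn v j)
    p′-irrefl : ∀ i → p′ i i ≡ false
    p′-irrefl i = p-irrefl (punchIn v i)
    halve : ∀ {x y} → x + x ≡ y + y → x ≡ y
    halve {x} {y} x+x≡y+y = *-cancelˡ-≡ x y 2 (begin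
      x + (x + 0)  ≡⟨ cong (x +_) (+-identityʳ x) ⟩
      x + x        ≡⟨ x+x≡y+y ⟩
      y + y        ≡⟨ cong (y +_) (≡-sym (+-identityʳ y)) ⟩
      y + (y + 0)  ∎)

countPairs-cong : {p q : Fin n → Fin n → Bool} → (∀ i j → p i j ≡ q i j) → countPairs p ≡ countPairs q
countPairs-cong p≗q = sumFin-cong (λ i → count-cong (λ j → cong (does (toℕ i <? toℕ j) ∧_) (p≗q i j)))

-- Greedy colouring of degenerate graphs

data Degenerate (d : ℕ) : ∀ {n} → (Fin n → Fin n → Bool) → Set where
  empty  : {A : Fin 0 → Fin 0 → Bool} → Degenerate d A
  remove : ∀ {n} {A : Fin (suc n) → Fin (suc n) → Bool} (v : Fin (suc n)) →
           count (neighbours A v) ≤ d → Degenerate d (removeVertex A v) → Degenerate d A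

Degenerate-⊆ : ∀ {d} {A B : Fin n → Fin n → Bool} → (∀ i j → B i j ≡ true → A i j ≡ true) →
               Degenerate d A → Degenerate d B
Degenerate-⊆ B⊆A empty            = empty
Degenerate-⊆ B⊆A (remove v deg D) =
  remove v (≤-trans (count-mono (λ u → B⊆A v (punchIn v u))) deg)
           (Degenerate-⊆ (λ i j → B⊆A (punchIn v i) (punchIn v j)) D)

Degenerate-small : ∀ d {n} → n ≤ suc d → (A : Fin n → Fin n → Bool) → Degenerate d A
Degenerate-small d {zero}  _         A = empty
Degenerate-small d {suc n} (s≤s n≤d) A =
  remove zero (≤-trans (count≤n (neighbours A zero)) n≤d)
              (Degenerate-small d (≤-trans n≤d (n≤1+n d)) (removeVertex A zero))

Degenerate-degree : ∀ {d} (G : Graph (suc n)) (v : Fin (suc n)) → degree G v ≤ d →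
                    Degenerate d (adj (deleteVertex G v)) → Degenerate d (adj G)
Degenerate-degree G v v-degree = remove v (≤-trans (count-punchIn≤ v (adj G v)) v-degree)

good-colour : ∀ {d t} (B W : Fin n → Bool) (ψ : Fin n → Fin (d + t)) → count B ≤ d → 1 ≤ t →
              ∃ λ c → (∀ u → B u ≡ true → c ≢ ψ u) × clashes W ψ c * t ≤ count W
good-colour {n} {d} {t} B W ψ B≤d t≥1 =
  let c , c-free , c-cheapest = Fin-∃-minimal (λ c → free c Bool.≟ true) (clashes W ψ)
                                              (count>0⇒∃ (≤-trans t≥1 t≤free))
  in c , free-avoids-B c-free , cheapest-bound c c-cheapest
  where
  open ≤-Reasoning
  free : Fin (d + t) → Bool
  free c = not (positive (clashes B ψ c))
  t≤free : t ≤ count free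
  t≤free = +-cancelˡ-≤ d t (count free) (begin
    d + t                                       ≡⟨ ≡-sym (count-not (positive ∘ clashes B ψ)) ⟩
    count free + count (positive ∘ clashes B ψ) ≤⟨ +-monoʳ-≤ (count free) (count-positive≤sumFin (clashes B ψ)) ⟩
    count free + sumFin (clashes B ψ)           ≡⟨ cong (count free +_) (sumFin-clashes B ψ) ⟩
    count free + count B                        ≤⟨ +-monoʳ-≤ (count free) B≤d ⟩
    count free + d                              ≡⟨ +-comm (count free) d ⟩
    d + count free                              ∎)
  not-positive⇒≡0 : ∀ m → not (positive m) ≡ true → m ≡ 0
  not-positive⇒≡0 zero _ = refl
  free-avoids-B : ∀ {c} → free c ≡ true → ∀ u → B u ≡ true → c ≢ ψ u
  free-avoids-B {c} c-free u Bu c≡ψu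
    with () ← trans (≡-sym (count≡0⇒false (not-positive⇒≡0 (clashes B ψ c) c-free) u))
                    (cong₂ _∧_ Bu (dec-true (c ≟ ψ u) c≡ψu))
  cheapest-bound : ∀ c → (∀ c′ → free c′ ≡ true → clashes W ψ c ≤ clashes W ψ c′) →
                   clashes W ψ c * t ≤ count W
  cheapest-bound c c-cheapest = begin
    clashes W ψ c * t           ≤⟨ *-monoʳ-≤ (clashes W ψ c) t≤free ⟩
    clashes W ψ c * count free  ≡⟨ *-comm (clashes W ψ c) (count free) ⟩
    count free * clashes W ψ c  ≤⟨ count*≤sumFin free (clashes W ψ) c-cheapest ⟩
    sumFin (clashes W ψ)        ≡⟨ sumFin-clashes W ψ ⟩
    count W                     ∎

data PunchView {n} (v : Fin (suc n)) : Fin (suc n) → Set where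
  at-v    : PunchView v v
  punched : (w : Fin n) → PunchView v (punchIn v w)

punchView : (v x : Fin (suc n)) → PunchView v x
punchView v x with v ≟ x
... | yes refl = at-v
... | no v≢x   = subst (PunchView v) (punchIn-punchOut v≢x) (punched (punchOut v≢x))

insertAt-proper : (G : Graph (suc n)) (v : Fin (suc n)) {φ′ : Fin n → Fin k} {c : Fin k} →
                  ProperColoring (deleteVertex G v) k φ′ → (∀ u → neighbours (adj G) v u ≡ true → c ≢ φ′ u) →
                  ProperColoring G k (insertAt φ′ v c)
insertAt-proper G v {φ′} {c} φ′-proper c-free x y x~y with punchView v x | punchView v y
... | at-v      | at-v       = ⊥-elim (Edge-irrefl G x~y refl)
... | at-v      | punched w  = λ eq → c-free w x~y
                                 (trans (≡-sym (insertAt-lookup φ′ v c)) (trans eq (insertAt-punchIn φ′ v c w)))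
... | punched w | at-v       = λ eq → c-free w (Edge-sym G x~y)
                                 (trans (≡-sym (insertAt-lookup φ′ v c)) (trans (≡-sym eq) (insertAt-punchIn φ′ v c w)))
... | punched w | punched w′ = λ eq → φ′-proper w w′ x~y
                                 (trans (≡-sym (insertAt-punchIn φ′ v c w)) (trans eq (insertAt-punchIn φ′ v c w′)))

does-≟-sym : (x y : Fin k) → does (x ≟ y) ≡ does (y ≟ x)
does-≟-sym x y with x ≟ y | y ≟ x
... | yes _   | yes _   = refl
... | no _    | no _    = refl
... | yes x≡y | no y≢x  = ⊥-elim (y≢x (≡-sym x≡y))
... | no x≢y  | yes y≡x = ⊥-elim (x≢y (≡-sym y≡x))

mono-insertAt : (H : Graph (suc n)) (v : Fin (suc n)) (φ′ : Fin n → Fin k) (c : Fin k) →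
                mono H (insertAt φ′ v c) ≡ clashes (neighbours (adj H) v) φ′ c + mono (deleteVertex H v) φ′
mono-insertAt {n} {k} H v φ′ c = begin
  mono H φ                                                          ≡⟨ countPairs-removeVertex q q-sym q-irrefl v ⟩
  count (neighbours q v) + countPairs (removeVertex q v)            ≡⟨ cong₂ _+_ (count-cong row-v) (countPairs-cong away-from-v) ⟩
  clashes (neighbours (adj H) v) φ′ c + mono (deleteVertex H v) φ′  ∎
  where
  open ≡-Reasoning
  φ : Fin (suc n) → Fin k
  φ = insertAt φ′ v c
  q : Fin (suc n) → Fin (suc n) → Bool
  q x y = adj H x y ∧ does (φ x ≟ φ y)
  q-sym : ∀ x y → q x y ≡ q y x
  q-sym x y = cong₂ _∧_ (sym H x y) (does-≟-sym (φ x) (φ y))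
  q-irrefl : ∀ x → q x x ≡ false
  q-irrefl x rewrite irrefl H x = refl
  row-v : ∀ u → neighbours q v u ≡ (adj H v (punchIn v u) ∧ does (c ≟ φ′ u))
  row-v u = cong (adj H v (punchIn v u) ∧_)
                (cong₂ (λ a b → does (a ≟ b)) (insertAt-lookup φ′ v c) (insertAt-punchIn φ′ v c u))
  away-from-v : ∀ i j → removeVertex q v i j ≡ (adj H (punchIn v i) (punchIn v j) ∧ does (φ′ i ≟ φ′ j))
  away-from-v i j = cong (adj H (punchIn v i) (punchIn v j) ∧_)
                  (cong₂ (λ a b → does (a ≟ b)) (insertAt-punchIn φ′ v c i) (insertAt-punchIn φ′ v c j))

degenerate-coloring : ∀ {d t} (G H : Graph n) → Degenerate d (adj G) → 1 ≤ t →
                      Σ (Fin n → Fin (d + t)) λ φ → ProperColoring G (d + t) φ × mono H φ * t ≤ numEdges H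
degenerate-coloring G H empty _ = (λ ()) , (λ ()) , z≤n
degenerate-coloring {t = t} G H (remove v deg D) t≥1
  with degenerate-coloring (deleteVertex G v) (deleteVertex H v) D t≥1
... | φ′ , φ′-proper , φ′-bound
  with good-colour (neighbours (adj G) v) (neighbours (adj H) v) φ′ deg t≥1
... | c , c-free , c-cheap = insertAt φ′ v c , insertAt-proper G v φ′-proper c-free , (begin
    mono H (insertAt φ′ v c) * t
      ≡⟨ cong (_* t) (mono-insertAt H v φ′ c) ⟩
    (clashes (neighbours (adj H) v) φ′ c + mono (deleteVertex H v) φ′) * t
      ≡⟨ *-distribʳ-+ t (clashes (neighbours (adj H) v) φ′ c) (mono (deleteVertex H v) φ′) ⟩
    clashes (neighbours (adj H) v) φ′ c * t + mono (deleteVertex H v) φ′ * t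
      ≤⟨ +-mono-≤ c-cheap φ′-bound ⟩
    count (neighbours (adj H) v) + numEdges (deleteVertex H v)
      ≡⟨ ≡-sym (countPairs-removeVertex (adj H) (sym H) (irrefl H) v) ⟩
    numEdges H
      ∎)
  where open ≤-Reasoning

degenerate-minMono-bound : ∀ d (G H : Graph n) → Degenerate d (adj G) →
                           ∀ k m → IsMinMono G H k m → m * (k ∸ d) ≤ numEdges H
degenerate-minMono-bound d G H D k m (_ , minimal) with d <? k
... | no d≮k rewrite m≤n⇒m∸n≡0 (≮⇒≥ d≮k) | *-zeroʳ m = z≤n
... | yes d<k with degenerate-coloring G H D (m<n⇒0<n∸m d<k)
...   | φ , φ-proper , φ-bound = ≤-trans (*-monoˡ-≤ (k ∸ d) (minimal′ φ φ-proper)) φ-bound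
  where
  minimal′ : ∀ φ → ProperColoring G (d + (k ∸ d)) φ → m ≤ mono H φ
  minimal′ = subst (λ k′ → ∀ φ → ProperColoring G k′ φ → m ≤ mono H φ)
                   (≡-sym (m+[n∸m]≡n (<⇒≤ d<k))) minimal

-- ℓ-trees and series-parallel graphs

lTree-degenerate : ∀ {ℓ} {G : Graph n} → IsLTree ℓ G → Degenerate ℓ (adj G)
lTree-degenerate {ℓ = ℓ} (base G _)        = Degenerate-small ℓ ≤-refl (adj G)
lTree-degenerate (add G v v-degree _ G-v) = Degenerate-degree G v (≤-reflexive v-degree) (lTree-degenerate G-v)

support : MG n → Fin n → Fin n → Bool
support M i j = positive (M i j)

bump-sym : (a b i j : Fin n) → bump a b i j ≡ bump a b j i
bump-sym a b i j = cong (λ e → if e then 1 else 0) (begin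
  (does (i ≟ a) ∧ does (j ≟ b)) ∨ (does (i ≟ b) ∧ does (j ≟ a))
    ≡⟨ Bool.∨-comm (does (i ≟ a) ∧ does (j ≟ b)) _ ⟩
  (does (i ≟ b) ∧ does (j ≟ a)) ∨ (does (i ≟ a) ∧ does (j ≟ b))
    ≡⟨ cong₂ _∨_ (Bool.∧-comm (does (i ≟ b)) _) (Bool.∧-comm (does (i ≟ a)) _) ⟩
  (does (j ≟ a) ∧ does (i ≟ b)) ∨ (does (j ≟ b) ∧ does (i ≟ a))
    ∎)
  where open ≡-Reasoning

positive-∸1 : ∀ {m} → 2 ≤ m → positive (m ∸ 1) ≡ true
positive-∸1 (s≤s (s≤s _)) = refl

support-∸bump : {M : MG n} → (∀ i j → M i j ≡ M j i) → ∀ {a b} → 2 ≤ M a b →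
                ∀ i j → support M i j ≡ true → support (λ i j → M i j ∸ bump a b i j) i j ≡ true
support-∸bump M-sym {a} {b} 2≤Mab i j Mij>0 with i ≟ a | j ≟ b | i ≟ b | j ≟ a
... | yes refl | yes refl | _        | _        = positive-∸1 2≤Mab
... | yes refl | no _     | yes refl | yes refl = positive-∸1 2≤Mab
... | yes _    | no _     | yes _    | no _     = Mij>0
... | yes _    | no _     | no _     | _        = Mij>0
... | no _     | _        | yes refl | yes refl = positive-∸1 (subst (2 ≤_) (M-sym a b) 2≤Mab)
... | no _     | _        | yes _    | no _     = Mij>0
... | no _     | _        | no _     | _        = Mij>0

reducesToK2-degenerate : {M : MG n} → (∀ i j → M i j ≡ M j i) → ReducesToK2 M → Degenerate 2 (support M)
reducesToK2-degenerate _ (isK2 M _) = Degenerate-small 2 (s≤s (s≤s z≤n)) (support M)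
reducesToK2-degenerate M-sym (suppress M v a b _ v-degree _ _ R) =
  remove v (begin
    count (neighbours (support M) v)  ≤⟨ count-punchIn≤ v (support M v) ⟩
    count (support M v)               ≤⟨ count-positive≤sumFin (M v) ⟩
    mdeg M v                          ≡⟨ v-degree ⟩
    2                                 ∎)
    (Degenerate-⊆ support⊆ (reducesToK2-degenerate M′-sym R))
  where
  open ≤-Reasoning
  M′-sym : ∀ i j → M (punchIn v i) (punchIn v j) + bump a b i j ≡ M (punchIn v j) (punchIn v i) + bump a b j i
  M′-sym i j = cong₂ _+_ (M-sym (punchIn v i) (punchIn v j)) (bump-sym a b i j)
  support⊆ : ∀ i j → removeVertex (support M) v i j ≡ true →
             support (λ i j → M (punchIn v i) (punchIn v j) + bump a b i j) i j ≡ true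
  support⊆ i j with M (punchIn v i) (punchIn v j)
  ... | suc _ = λ _ → refl
reducesToK2-degenerate M-sym (delParallel M a b _ 2≤Mab R) =
  Degenerate-⊆ (support-∸bump M-sym 2≤Mab) (reducesToK2-degenerate M′-sym R)
  where
  M′-sym : ∀ i j → M i j ∸ bump a b i j ≡ M j i ∸ bump a b j i
  M′-sym i j = cong₂ _∸_ (M-sym i j) (bump-sym a b i j)

seriesParallel-degenerate : (G : Graph n) → IsSeriesParallel G → Degenerate 2 (adj G)
seriesParallel-degenerate G R =
  Degenerate-⊆ adj⊆support (reducesToK2-degenerate (λ i j → cong (λ e → if e then 1 else 0) (sym G i j)) R)
  where
  adj⊆support : ∀ i j → adj G i j ≡ true → support (toMG G) i j ≡ true
  adj⊆support i j Gij rewrite Gij = refl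

-- Forests

module _ {A : Set} where

  prefix : {y : A} {xs : List A} → y ∈ xs → List A
  prefix {xs = x ∷ _} (here _)  = x ∷ []
  prefix {xs = x ∷ _} (there p) = x ∷ prefix p

  prefix-nonempty : {y : A} {xs : List A} (p : y ∈ xs) → 1 ≤ length (prefix p)
  prefix-nonempty (here _)  = s≤s z≤n
  prefix-nonempty (there _) = s≤s z≤n

  prefix-All : {P : A → Set} {y : A} {xs : List A} → All P xs → (p : y ∈ xs) → All P (prefix p)
  prefix-All (px ∷ _)   (here _)  = px ∷ []
  prefix-All (px ∷ pxs) (there p) = px ∷ prefix-All pxs p

  prefix-Unique : {y : A} {xs : List A} → Unique xs → (p : y ∈ xs) → Unique (prefix p)
  prefix-Unique (_  ∷ _) (here _)  = [] ∷ []
  prefix-Unique (x∉ ∷ u) (there p) = prefix-All x∉ p ∷ prefix-Unique u p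

  lookup-injective : {xs : List A} → Unique xs → Injective _≡_ _≡_ (lookup xs)
  lookup-injective (_  ∷ _) {zero}  {zero}  _  = refl
  lookup-injective (x∉ ∷ _) {zero}  {suc j} eq = ⊥-elim (All.lookup x∉ (∈-lookup j) eq)
  lookup-injective (x∉ ∷ _) {suc i} {zero}  eq = ⊥-elim (All.lookup x∉ (∈-lookup i) (≡-sym eq))
  lookup-injective (_  ∷ u) {suc i} {suc j} eq = cong suc (lookup-injective u eq)

Unique-length≤ : {xs : List (Fin n)} → Unique xs → length xs ≤ n
Unique-length≤ u = injective⇒≤ (lookup-injective u)

LastIs-cons : (x : Fin n) {ys : List (Fin n)} {z : Fin n} → LastIs ys z → LastIs (x ∷ ys) z
LastIs-cons x (lastOne y)            = lastMore x y [] y (lastOne y)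
LastIs-cons x (lastMore y y′ ys z L) = lastMore x y (y′ ∷ ys) z (lastMore y y′ ys z L)

prefix-LastIs : {y : Fin n} {xs : List (Fin n)} (p : y ∈ xs) → LastIs (prefix p) y
prefix-LastIs (here refl)       = lastOne _
prefix-LastIs (there {x = x} p) = LastIs-cons x (prefix-LastIs p)

prefix-Path : (G : Graph n) {y : Fin n} {xs : List (Fin n)} → Path G xs → (p : y ∈ xs) → Path G (prefix p)
prefix-Path G (single u)          (here _)          = single u
prefix-Path G (cons u w ws _ _)   (here _)          = single u
prefix-Path G (cons u w ws u~w _) (there (here _))  = cons u w [] u~w (single w)
prefix-Path G (cons u w ws u~w P) (there (there p)) = cons u w (prefix p) u~w (prefix-Path G P (there p))

module _ (G : Graph (suc n)) (v : Fin (suc n)) where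

  map-Path : {l : List (Fin n)} → Path (deleteVertex G v) l → Path G (map (punchIn v) l)
  map-Path (single u)          = single (punchIn v u)
  map-Path (cons u w ws u~w P) = cons (punchIn v u) (punchIn v w) (map (punchIn v) ws) u~w (map-Path P)

  map-LastIs : {l : List (Fin n)} {z : Fin n} → LastIs l z → LastIs (map (punchIn v) l) (punchIn v z)
  map-LastIs (lastOne x)           = lastOne (punchIn v x)
  map-LastIs (lastMore x y ys z L) = lastMore (punchIn v x) (punchIn v y) (map (punchIn v) ys) (punchIn v z) (map-LastIs L)

  deleteVertex-acyclic : ¬ HasCycle G → ¬ HasCycle (deleteVertex G v)
  deleteVertex-acyclic acyclic ((x ∷ xs) , v₀ , vₗ , length≥3 , u , P , x≡v₀ , L , vₗ~v₀) =
    acyclic ( map (punchIn v) (x ∷ xs) , punchIn v v₀ , punchIn v vₗ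
            , subst (3 ≤_) (≡-sym (length-map (punchIn v) (x ∷ xs))) length≥3
            , map⁺ (punchIn-injective v _ _) u , map-Path P , cong (punchIn v) x≡v₀ , map-LastIs L , vₗ~v₀ )

-- In an acyclic graph of minimum degree ≥ 2 paths could be made arbitrarily long:
-- extending one at its head by a neighbour other than the previous vertex either
-- keeps it a path or closes a cycle.
module _ (G : Graph (suc n)) (acyclic : ¬ HasCycle G) (branching : ∀ x z → ∃ λ y → Edge G x y × y ≢ z) where

  extend-path : ∀ x xs → Unique (x ∷ xs) → Path G (x ∷ xs) → ∃ λ y → Unique (y ∷ x ∷ xs) × Path G (y ∷ x ∷ xs)
  extend-path x [] u P with branching x x
  ... | y , x~y , y≢x = y , (y≢x ∷ []) ∷ u , cons y x [] (Edge-sym G x~y) P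
  extend-path x (z ∷ rest) u P with branching x z
  ... | y , x~y , y≢z with Any.any? (y ≟_) (x ∷ z ∷ rest)
  ...   | no y∉                  = y , ¬Any⇒All¬ (x ∷ z ∷ rest) y∉ ∷ u , cons y x (z ∷ rest) (Edge-sym G x~y) P
  ...   | yes (here y≡x)         = ⊥-elim (Edge-irrefl G x~y (≡-sym y≡x))
  ...   | yes (there (here y≡z)) = ⊥-elim (y≢z y≡z)
  ...   | yes (there (there p))  = ⊥-elim (acyclic
          ( prefix (there (there p)) , x , y , s≤s (s≤s (prefix-nonempty p))
          , prefix-Unique u (there (there p)) , prefix-Path G P (there (there p))
          , refl , prefix-LastIs (there (there p)) , Edge-sym G x~y ))

  long-path : ∀ m → ∃ λ x → ∃ λ xs → length xs ≡ m × Unique (x ∷ xs) × Path G (x ∷ xs)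
  long-path zero    = zero , [] , refl , [] ∷ [] , single zero
  long-path (suc m) with long-path m
  ... | x , xs , refl , u , P with extend-path x xs u P
  ...   | y , u′ , P′ = y , x ∷ xs , refl , u′ , P′

other-neighbour : (G : Graph n) (x : Fin n) → ¬ degree G x ≤ 1 → ∀ z → ∃ λ y → Edge G x y × y ≢ z
other-neighbour G x x-not-leaf z with any? (λ y → (adj G x y Bool.≟ true) ×-dec ¬? (y ≟ z))
... | yes found = found
... | no none   = ⊥-elim (x-not-leaf (count≤1 λ y y′ x~y x~y′ → trans (at-z x~y) (≡-sym (at-z x~y′))))
  where
  at-z : ∀ {y} → Edge G x y → y ≡ z
  at-z {y} x~y = decidable-stable (y ≟ z) (λ y≢z → none (y , x~y , y≢z))

acyclic-leaf : (G : Graph (suc n)) → ¬ HasCycle G → ∃ λ v → degree G v ≤ 1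
acyclic-leaf {n} G acyclic with any? (λ v → degree G v ≤? 1)
... | yes leaf   = leaf
... | no no-leaf with long-path G acyclic (λ x → other-neighbour G x (λ x-leaf → no-leaf (x , x-leaf))) (suc n)
...   | x , xs , length≡ , u , _ = ⊥-elim (1+n≰n (subst (_≤ suc n) (cong suc length≡) (Unique-length≤ u)))

acyclic-degenerate : (G : Graph n) → ¬ HasCycle G → Degenerate 1 (adj G)
acyclic-degenerate {zero}  G _       = empty
acyclic-degenerate {suc n} G acyclic =
  let v , v-leaf = acyclic-leaf G acyclic in
  Degenerate-degree G v v-leaf (acyclic-degenerate (deleteVertex G v) (deleteVertex-acyclic G v acyclic))

-- Outerplanar graphs

NonCrossing : Graph n → (Fin n → ℕ) → Set
NonCrossing G s = ∀ a b c d → Edge G a b → Edge G c d → ¬ (s a < s c × s c < s b × s b < s d)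

module _ (G : Graph n) (s : Fin n → ℕ) (s-injective : Injective _≡_ _≡_ s) (non-crossing : NonCrossing G s) where

  Between : Fin n → Fin n → Fin n → Set
  Between a b z = s a < s z × s z < s b

  between? : ∀ a b → Decidable (Between a b)
  between? a b z = (s a <? s z) ×-dec (s z <? s b)

  Next : Fin n → Fin n → Set
  Next w u = s w < s u × (∀ z → ¬ Between w u z)

  Next-unique : ∀ {w u u′} → Next w u → Next w u′ → u ≡ u′
  Next-unique {u = u} {u′} (w<u , u-next) (w<u′ , u′-next) with <-cmp (s u) (s u′)
  ... | tri< u<u′ _ _ = ⊥-elim (u′-next u (w<u , u<u′))
  ... | tri≈ _ u≈u′ _ = s-injective u≈u′
  ... | tri> _ _ u′<u = ⊥-elim (u-next u′ (w<u′ , u′<u))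

  Chord : Fin n × Fin n → Set
  Chord (a , b) = Edge G a b × ∃ (Between a b)

  chord? : Decidable Chord
  chord? (a , b) = (adj G a b Bool.≟ true) ×-dec any? (between? a b)

  span : Fin n × Fin n → ℕ
  span (a , b) = s b ∸ s a

  degree≤2 : (w a : Fin n) → (∀ u → Edge G w u → u ≡ a ⊎ Next w u) → degree G w ≤ 2
  degree≤2 w a a-or-next = count≤2 a (Next w) a-or-next (λ _ _ → Next-unique)

  chordless-degree≤2 : (∀ ab → ¬ Chord ab) → (w : Fin n) → (∀ y → s w ≤ s y) → degree G w ≤ 2
  chordless-degree≤2 no-chord w w-first = degree≤2 w w λ u w~u →
    inj₂ (≤∧≢⇒< (w-first u) (Edge-irrefl G w~u ∘ s-injective) , λ z w<z<u → no-chord (w , u) (w~u , z , w<z<u))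

  -- A neighbour of w beyond the next vertex would give a chord shorter than ab,
  -- one outside [a, b] a crossing with ab.
  shortest-chord-degree≤2 : ∀ a b → Chord (a , b) → (∀ ab′ → Chord ab′ → span (a , b) ≤ span ab′) →
                            ∀ w → Between a b w → (∀ y → Between a b y → s w ≤ s y) → degree G w ≤ 2
  shortest-chord-degree≤2 a b (a~b , _) ab-shortest w (a<w , w<b) w-first = degree≤2 w a neighbour
    where
    neighbour : ∀ u → Edge G w u → u ≡ a ⊎ Next w u
    neighbour u w~u with <-cmp (s u) (s a)
    ... | tri< u<a _ _ = ⊥-elim (non-crossing u w a b (Edge-sym G w~u) a~b (u<a , a<w , w<b))
    ... | tri≈ _ u≈a _ = inj₁ (s-injective u≈a)
    ... | tri> _ _ a<u with <-cmp (s u) (s w)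
    ...   | tri< u<w _ _ = ⊥-elim (<⇒≱ u<w (w-first u (a<u , <-trans u<w w<b)))
    ...   | tri≈ _ u≈w _ = ⊥-elim (Edge-irrefl G w~u (≡-sym (s-injective u≈w)))
    ...   | tri> _ _ w<u with s b <? s u
    ...     | yes b<u = ⊥-elim (non-crossing a b w u a~b w~u (a<w , w<b , b<u))
    ...     | no b≮u  = inj₂ (w<u , λ z w<z<u → <⇒≱ shorter (ab-shortest (w , u) (w~u , z , w<z<u)))
      where
      shorter : s u ∸ s w < s b ∸ s a
      shorter = ≤-<-trans (∸-monoˡ-≤ (s w) (≮⇒≥ b≮u)) (∸-monoʳ-< a<w (<⇒≤ w<b))

  nonCrossing-low-degree : Fin n → ∃ λ w → degree G w ≤ 2
  nonCrossing-low-degree x₀ with pair-any? chord?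
  ... | no no-chord =
    let w , _ , w-first = Fin-∃-minimal (λ _ → yes tt) s (x₀ , tt)
    in w , chordless-degree≤2 (λ ab c → no-chord (ab , c)) w (λ y → w-first y tt)
  ... | yes chord =
    let (a , b) , ab-chord , ab-shortest =
          ∃-minimal Chord span (λ l → pair-any? (λ ab → chord? ab ×-dec (span ab <? l))) chord
        w , w-between , w-first = Fin-∃-minimal (between? a b) s (proj₂ ab-chord)
    in w , shortest-chord-degree≤2 a b ab-chord ab-shortest w w-between w-first

nonCrossing-degenerate : (G : Graph n) (s : Fin n → ℕ) → Injective _≡_ _≡_ s → NonCrossing G s → Degenerate 2 (adj G)
nonCrossing-degenerate {zero}  G s _           _            = empty
nonCrossing-degenerate {suc n} G s s-injective non-crossing =
  let w , w-degree = nonCrossing-low-degree G s s-injective non-crossing zero in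
  Degenerate-degree G w w-degree
    (nonCrossing-degenerate (deleteVertex G w) (s ∘ punchIn w) (punchIn-injective w _ _ ∘ s-injective)
       (λ a b c d → non-crossing (punchIn w a) (punchIn w b) (punchIn w c) (punchIn w d)))

outerplanar-degenerate : (G : Graph n) → IsOuterplanar G → Degenerate 2 (adj G)
outerplanar-degenerate G (σ , σ-injective , non-crossing) =
  nonCrossing-degenerate G (toℕ ∘ σ) (σ-injective ∘ toℕ-injective) non-crossing

corollary11 :
  -- (i) trees
  (∀ {n} (G H : Graph n) → SubgraphOfComplement H G →
    ∀ (k c : ℕ) → IsChromaticNumber G c → c ≤ k →
    IsTree G →
    ∀ m → IsMinMono G H k m → m * (k ∸ 1) ≤ numEdges H)
  ×
  -- (ii) simple series-parallel graphs with χ(G) = 3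
  (∀ {n} (G H : Graph n) → SubgraphOfComplement H G →
    ∀ (k : ℕ) → IsChromaticNumber G 3 → 3 ≤ k →
    IsSeriesParallel G →
    ∀ m → IsMinMono G H k m → m * (k ∸ 2) ≤ numEdges H)
  ×
  -- (iii) simple bipartite outerplanar graphs, k > 2
  (∀ {n} (G H : Graph n) → SubgraphOfComplement H G →
    ∀ (k c : ℕ) → IsChromaticNumber G c → c ≤ k → 2 < k →
    IsBipartite G → IsOuterplanar G →
    ∀ m → IsMinMono G H k m → m * (k ∸ 2) ≤ numEdges H)
  ×
  -- (iv) ℓ-trees with χ(G) = ℓ + 1
  (∀ {n} (ℓ : ℕ) (G H : Graph n) → SubgraphOfComplement H G →
    ∀ (k : ℕ) → IsChromaticNumber G (suc ℓ) → suc ℓ ≤ k →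
    IsLTree ℓ G →
    ∀ m → IsMinMono G H k m → m * (k ∸ ℓ) ≤ numEdges H)
corollary11 =
  (λ G H _ k _ _ _ (_ , _ , acyclic) →
     degenerate-minMono-bound 1 G H (acyclic-degenerate G acyclic) k) ,
  (λ G H _ k _ _ seriesParallel →
     degenerate-minMono-bound 2 G H (seriesParallel-degenerate G seriesParallel) k) ,
  (λ G H _ k _ _ _ _ _ outerplanar →
     degenerate-minMono-bound 2 G H (outerplanar-degenerate G outerplanar) k) ,
  (λ ℓ G H _ k _ _ lTree →
     degenerate-minMono-bound ℓ G H (lTree-degenerate lTree) k)
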